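{- Let $n\ge 3$ and let $G=\{M_1,\dots,M_r\}\subseteq{\rm H}(n,\mathbb{Q})$ with $\psi(M_i)=(\mathbf a_i,\mathbf b_i,c_i)$, such that $\mathbf a_i\cdot\mathbf b_j=\mathbf a_j\cdot\mathbf b_i$ for all $1\le i\neq j\le r$. If there exists a product $M=M_{i_1}M_{i_2}\cdots M_{i_k}$ with $i_j\in[1,r]$ for all $1\le j\le k$ such that $\psi(M)=(\mathbf 0,\mathbf 0,c)$ for some $c\in\mathbb{Q}$, then $$c=\sum_{j=1}^{k}\Big(c_{i_j}-\frac12\,\mathbf a_{i_j}\cdot\mathbf b_{i_j}\Big).$$
   Context: ${\rm H}(n,\mathbb{Q})$ is the group of $n\times n$ matrices $\begin{pmatrix}1&\mathbf a^{\mathsf T}&c\\0&I_{n-2}&\mathbf b\\0&0&1\end{pmatrix}$ with $\mathbf a,\mathbf b\in\mathbb{Q}^{n-2}$, $c\in\mathbb{Q}$; for such $M$, $\psi(M)=(\mathbf a,\mathbf b,c)$. $\cdot$ is the dot product. -}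

module Defs where

open import Data.Nat using (ℕ; zero; suc)
open import Data.Fin using (Fin; zero; suc)
open import Data.List using (List; []; _∷_)
import Data.Fin
import Relation.Nullary
open import Data.Rational using (ℚ; 0ℚ; 1ℚ; ½; _+_; _*_; _-_)

Mat : ℕ → Set
Mat n = Fin n → Fin n → ℚ

sumF : ∀ {k} → (Fin k → ℚ) → ℚ
sumF {zero}  f = 0ℚ
sumF {suc k} f = f zero + sumF (λ i → f (suc i))

_·_ : ∀ {m} → (Fin m → ℚ) → (Fin m → ℚ) → ℚ
u · v = sumF (λ i → u i * v i)

_⊗_ : ∀ {n} → Mat n → Mat n → Mat n
(A ⊗ B) i j = sumF (λ l → A i l * B l j)

idMat : ∀ {n} → Mat n
idMat zero    zero    = 1ℚ
idMat zero    (suc j) = 0ℚ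
idMat (suc i) zero    = 0ℚ
idMat (suc i) (suc j) = idMat i j

prodMat : ∀ {n} → List (Mat n) → Mat n
prodMat []       = idMat
prodMat (A ∷ As) = A ⊗ prodMat As

data Pos (m : ℕ) : Set where
  first : Pos m
  mid   : Fin m → Pos m
  last  : Pos m

pos : ∀ {m} → Fin (suc (suc m)) → Pos m
pos zero = first
pos {zero} (suc zero) = last
pos {suc m} (suc i) with pos {m} i
... | first = mid zero
... | mid k = mid (suc k)
... | last  = last

-- the Heisenberg matrix with ψ-coordinates (a, b, c), n = m + 2:
--   [ 1  aᵀ  c ]
--   [ 0  I   b ]
--   [ 0  0   1 ]
entry : ∀ {m} → (Fin m → ℚ) → (Fin m → ℚ) → ℚ → Pos m → Pos m → ℚ
entry a b c first first   = 1ℚ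
entry a b c first (mid j) = a j
entry a b c first last    = c
entry a b c (mid i) first = 0ℚ
entry a b c (mid i) (mid j) with i Data.Fin.≟ j
... | Relation.Nullary.yes _ = 1ℚ
... | Relation.Nullary.no  _ = 0ℚ
entry a b c (mid i) last  = b i
entry a b c last last     = 1ℚ
entry a b c last _        = 0ℚ

HMat : ∀ {m} → (Fin m → ℚ) → (Fin m → ℚ) → ℚ → Mat (suc (suc m))
HMat a b c i j = entry a b c (pos i) (pos j)

zeroVec : ∀ {m} → Fin m → ℚ
zeroVec _ = 0ℚ

sumL : ∀ {r} → (Fin r → ℚ) → List (Fin r) → ℚ
sumL f []       = 0ℚ
sumL f (i ∷ is) = f i + sumL f is

-- Write φ(a, b, c) = c − ½ a·b. Multiplying Heisenberg matrices adds the a- and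
-- b-coordinates and gives corner c + c' + a·b', so that
--   φ(product) = φ(a, b, c) + φ(a', b', c') + ½ (a·b' − a'·b).
-- Along a word, the cross term pairs the head with the sum of the remaining
-- letters; by bilinearity and the pairwise symmetry a_i·b_j = a_j·b_i it
-- vanishes, so φ of the product is the sum of φ over the letters. A central
-- product has a = 0, hence φ equals its corner c.
module Submission where

open import Defs
open import Data.Nat using (ℕ; zero; suc; _≤_)
open import Data.Fin using (Fin; zero; suc; _≟_)
open import Data.List using (List; []; _∷_; map)
open import Data.List.NonEmpty using (List⁺; _∷_; toList)
open import Data.Rational using (ℚ; 0ℚ; 1ℚ; ½; _+_; _*_; _-_)
open import Data.Rational.Properties
  using ( +-identityˡ; +-identityʳ; *-identityˡ; *-identityʳ; *-zeroˡ; *-zeroʳ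
        ; *-distribˡ-+; *-distribʳ-+)
open import Data.Rational.Solver using (module +-*-Solver)
open +-*-Solver using (solve; _:+_; _:*_; _:-_; _:=_; con)
open import Data.Empty using (⊥-elim)
open import Function using (_∘_)
open import Relation.Nullary using (yes; no)
open import Relation.Binary.PropositionalEquality
  using (_≡_; _≢_; refl; sym; trans; cong; cong₂; module ≡-Reasoning)

open ≡-Reasoning

Vecℚ : ℕ → Set
Vecℚ m = Fin m → ℚ

_+ᵛ_ : ∀ {m} → Vecℚ m → Vecℚ m → Vecℚ m
(u +ᵛ v) k = u k + v k

sumF-cong : ∀ {k} {f g : Fin k → ℚ} → (∀ i → f i ≡ g i) → sumF f ≡ sumF g
sumF-cong {zero}  _ = refl
sumF-cong {suc k} h = cong₂ _+_ (h zero) (sumF-cong (h ∘ suc))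

sumF-zero : ∀ {k} {f : Fin k → ℚ} → (∀ i → f i ≡ 0ℚ) → sumF f ≡ 0ℚ
sumF-zero {zero}  _ = refl
sumF-zero {suc k} h = trans (cong₂ _+_ (h zero) (sumF-zero (h ∘ suc))) (+-identityʳ 0ℚ)

sumF-+ : ∀ {k} (f g : Fin k → ℚ) → sumF (λ i → f i + g i) ≡ sumF f + sumF g
sumF-+ {zero}  _ _ = sym (+-identityʳ 0ℚ)
sumF-+ {suc k} f g =
  trans (cong ((f zero + g zero) +_) (sumF-+ (f ∘ suc) (g ∘ suc)))
    (solve 4 (λ x y z w → (x :+ y) :+ (z :+ w) := (x :+ z) :+ (y :+ w)) refl
       (f zero) (g zero) (sumF (f ∘ suc)) (sumF (g ∘ suc)))

·-distribˡ-+ᵛ : ∀ {m} (u v w : Vecℚ m) → u · (v +ᵛ w) ≡ u · v + u · w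
·-distribˡ-+ᵛ u v w = trans (sumF-cong (λ k → *-distribˡ-+ (u k) (v k) (w k)))
  (sumF-+ (λ k → u k * v k) (λ k → u k * w k))

·-distribʳ-+ᵛ : ∀ {m} (u v w : Vecℚ m) → (u +ᵛ v) · w ≡ u · w + v · w
·-distribʳ-+ᵛ u v w = trans (sumF-cong (λ k → *-distribʳ-+ (w k) (u k) (v k)))
  (sumF-+ (λ k → u k * w k) (λ k → v k * w k))

·-zeroˡ : ∀ {m} {u : Vecℚ m} (v : Vecℚ m) → (∀ k → u k ≡ 0ℚ) → u · v ≡ 0ℚ
·-zeroˡ v u≗0 = sumF-zero (λ k → trans (cong (_* v k) (u≗0 k)) (*-zeroˡ (v k)))

idMat-diag : ∀ {n} (i : Fin n) → idMat i i ≡ 1ℚ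
idMat-diag zero    = refl
idMat-diag (suc i) = idMat-diag i

idMat-offdiag : ∀ {n} {i j : Fin n} → i ≢ j → idMat i j ≡ 0ℚ
idMat-offdiag {i = zero}  {zero}  i≢j = ⊥-elim (i≢j refl)
idMat-offdiag {i = zero}  {suc j} _   = refl
idMat-offdiag {i = suc i} {zero}  _   = refl
idMat-offdiag {i = suc i} {suc j} i≢j = idMat-offdiag (i≢j ∘ cong suc)

sumF-*-idMat : ∀ {n} (f : Fin n → ℚ) j → sumF (λ l → f l * idMat l j) ≡ f j
sumF-*-idMat f zero =
  trans (cong₂ _+_ (*-identityʳ (f zero)) (sumF-zero (λ l → *-zeroʳ (f (suc l)))))
    (+-identityʳ (f zero))
sumF-*-idMat f (suc j) =
  trans (cong₂ _+_ (*-zeroʳ (f zero)) (sumF-*-idMat (f ∘ suc) j)) (+-identityˡ (f (suc j)))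

sumF-idMat-* : ∀ {n} (f : Fin n → ℚ) i → sumF (λ l → idMat i l * f l) ≡ f i
sumF-idMat-* f zero =
  trans (cong₂ _+_ (*-identityˡ (f zero)) (sumF-zero (λ l → *-zeroˡ (f (suc l)))))
    (+-identityʳ (f zero))
sumF-idMat-* f (suc i) =
  trans (cong₂ _+_ (*-zeroˡ (f zero)) (sumF-idMat-* (f ∘ suc) i)) (+-identityˡ (f (suc i)))

entry-mid-mid : ∀ {m} (a b : Vecℚ m) c i j → entry a b c (mid i) (mid j) ≡ idMat i j
entry-mid-mid a b c i j with i ≟ j
... | yes refl = sym (idMat-diag i)
... | no  i≢j  = sym (idMat-offdiag i≢j)

shift : ∀ {m} → Pos m → Pos (suc m)
shift first   = mid zero
shift (mid k) = mid (suc k)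
shift last    = last

pos-suc : ∀ {m} (i : Fin (suc (suc m))) → pos {suc m} (suc i) ≡ shift (pos i)
pos-suc {m} i with pos {m} i
... | first = refl
... | mid k = refl
... | last  = refl

sumF-pos : ∀ {m} (g : Pos m → ℚ) →
  sumF (λ i → g (pos i)) ≡ g first + sumF (λ k → g (mid k)) + g last
sumF-pos {zero} g =
  solve 2 (λ x y → x :+ (y :+ con 0ℚ) := x :+ con 0ℚ :+ y) refl (g first) (g last)
sumF-pos {suc m} g =
  trans (cong (g first +_) (trans (sumF-cong (cong g ∘ pos-suc)) (sumF-pos (g ∘ shift))))
    (solve 4 (λ x y z w → x :+ (y :+ z :+ w) := x :+ (y :+ z) :+ w) refl
       (g first) (g (mid zero)) (sumF (λ k → g (mid (suc k)))) (g last))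

ix : ∀ {m} → Pos m → Fin (suc (suc m))
ix first                 = zero
ix {zero}  (mid ())
ix {zero}  last          = suc zero
ix {suc m} (mid zero)    = suc zero
ix {suc m} (mid (suc k)) = suc (ix (mid k))
ix {suc m} last          = suc (ix {m} last)

pos-ix : ∀ {m} (x : Pos m) → pos (ix x) ≡ x
pos-ix first                 = refl
pos-ix {zero}  last          = refl
pos-ix {suc m} (mid zero)    = refl
pos-ix {suc m} (mid (suc k)) = trans (pos-suc (ix (mid k))) (cong shift (pos-ix (mid k)))
pos-ix {suc m} last          = trans (pos-suc (ix {m} last)) (cong shift (pos-ix {m} last))

_≈ᴹ_ : ∀ {n} → Mat n → Mat n → Set
A ≈ᴹ B = ∀ p q → A p q ≡ B p q

⊗-congˡ : ∀ {n} (A : Mat n) {B B' : Mat n} → B ≈ᴹ B' → (A ⊗ B) ≈ᴹ (A ⊗ B')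
⊗-congˡ A B≈B' p q = sumF-cong (λ l → cong (A p l *_) (B≈B' l q))

⊗-identityʳ : ∀ {n} (A : Mat n) → (A ⊗ idMat) ≈ᴹ A
⊗-identityʳ A p = sumF-*-idMat (A p)

sumF-*-entry-mid : ∀ {m} (a b : Vecℚ m) c (f : Vecℚ m) j →
  sumF (λ k → f k * entry a b c (mid k) (mid j)) ≡ f j
sumF-*-entry-mid a b c f j =
  trans (sumF-cong (λ k → cong (f k *_) (entry-mid-mid a b c k j))) (sumF-*-idMat f j)

sumF-entry-mid-* : ∀ {m} (a b : Vecℚ m) c (f : Vecℚ m) i →
  sumF (λ k → entry a b c (mid i) (mid k) * f k) ≡ f i
sumF-entry-mid-* a b c f i =
  trans (sumF-cong (λ k → cong (_* f k) (entry-mid-mid a b c i k))) (sumF-idMat-* f i)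

+-congᵐ : ∀ x y {s t : ℚ} → s ≡ t → x + s + y ≡ x + t + y
+-congᵐ x y = cong (λ s → x + s + y)

entry-⊗ : ∀ {m} (a b : Vecℚ m) c (a' b' : Vecℚ m) c' (x y : Pos m) →
  entry a b c x first * entry a' b' c' first y
  + sumF (λ k → entry a b c x (mid k) * entry a' b' c' (mid k) y)
  + entry a b c x last * entry a' b' c' last y
  ≡ entry (a +ᵛ a') (b +ᵛ b') (c + c' + a · b') x y
entry-⊗ a b c a' b' c' first first =
  trans (+-congᵐ (1ℚ * 1ℚ) (c * 0ℚ) (sumF-zero (*-zeroʳ ∘ a)))
    (solve 1 (λ z → con 1ℚ :* con 1ℚ :+ con 0ℚ :+ z :* con 0ℚ := con 1ℚ) refl c)
entry-⊗ a b c a' b' c' first (mid j) =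
  trans (+-congᵐ (1ℚ * a' j) (c * 0ℚ) (sumF-*-entry-mid a' b' c' a j))
    (solve 3 (λ x y z → con 1ℚ :* x :+ y :+ z :* con 0ℚ := y :+ x) refl (a' j) (a j) c)
entry-⊗ a b c a' b' c' first last =
  solve 3 (λ x y z → con 1ℚ :* x :+ y :+ z :* con 1ℚ := z :+ x :+ y) refl c' (a · b') c
entry-⊗ a b c a' b' c' (mid i) first =
  trans (+-congᵐ (0ℚ * 1ℚ) (b i * 0ℚ)
           (sumF-zero (λ k → *-zeroʳ (entry a b c (mid i) (mid k)))))
    (solve 1 (λ x → con 0ℚ :* con 1ℚ :+ con 0ℚ :+ x :* con 0ℚ := con 0ℚ) refl (b i))
entry-⊗ a b c a' b' c' (mid i) (mid j) =
  trans (+-congᵐ (0ℚ * a' j) (b i * 0ℚ)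
           (sumF-entry-mid-* a b c (λ k → entry a' b' c' (mid k) (mid j)) i))
    (trans (solve 3 (λ x y z → con 0ℚ :* x :+ y :+ z :* con 0ℚ := y) refl
              (a' j) (entry a' b' c' (mid i) (mid j)) (b i))
      (trans (entry-mid-mid a' b' c' i j)
        (sym (entry-mid-mid (a +ᵛ a') (b +ᵛ b') (c + c' + a · b') i j))))
entry-⊗ a b c a' b' c' (mid i) last =
  trans (+-congᵐ (0ℚ * c') (b i * 1ℚ) (sumF-entry-mid-* a b c b' i))
    (solve 3 (λ x y z → con 0ℚ :* x :+ y :+ z :* con 1ℚ := z :+ y) refl c' (b' i) (b i))
entry-⊗ {m} a b c a' b' c' last first =
  trans (+-congᵐ (0ℚ * 1ℚ) (1ℚ * 0ℚ) (sumF-zero {m} (λ _ → *-zeroʳ 0ℚ)))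
    (solve 0 (con 0ℚ :* con 1ℚ :+ con 0ℚ :+ con 1ℚ :* con 0ℚ := con 0ℚ) refl)
entry-⊗ a b c a' b' c' last (mid j) =
  trans (+-congᵐ (0ℚ * a' j) (1ℚ * 0ℚ)
           (sumF-zero (λ k → *-zeroˡ (entry a' b' c' (mid k) (mid j)))))
    (solve 1 (λ x → con 0ℚ :* x :+ con 0ℚ :+ con 1ℚ :* con 0ℚ := con 0ℚ) refl (a' j))
entry-⊗ a b c a' b' c' last last =
  trans (+-congᵐ (0ℚ * c') (1ℚ * 1ℚ) (sumF-zero (*-zeroˡ ∘ b')))
    (solve 1 (λ x → con 0ℚ :* x :+ con 0ℚ :+ con 1ℚ :* con 1ℚ := con 1ℚ) refl c')

HMat-⊗ : ∀ {m} (a b : Vecℚ m) c (a' b' : Vecℚ m) c' →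
  (HMat a b c ⊗ HMat a' b' c') ≈ᴹ HMat (a +ᵛ a') (b +ᵛ b') (c + c' + a · b')
HMat-⊗ a b c a' b' c' p q =
  trans (sumF-pos (λ x → entry a b c (pos p) x * entry a' b' c' x (pos q)))
    (entry-⊗ a b c a' b' c' (pos p) (pos q))

HMat-≈ᴹ⇒entry : ∀ {m} {a b a' b' : Vecℚ m} {c c'} → HMat a b c ≈ᴹ HMat a' b' c' →
  ∀ x y → entry a b c x y ≡ entry a' b' c' x y
HMat-≈ᴹ⇒entry {a = a} {b} {a'} {b'} {c} {c'} H x y = begin
  entry a b c x y                 ≡⟨ cong₂ (entry a b c) (pos-ix x) (pos-ix y) ⟨
  HMat a b c (ix x) (ix y)        ≡⟨ H (ix x) (ix y) ⟩
  HMat a' b' c' (ix x) (ix y)     ≡⟨ cong₂ (entry a' b' c') (pos-ix x) (pos-ix y) ⟩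
  entry a' b' c' x y              ∎

φ : ∀ {m} → Vecℚ m → Vecℚ m → ℚ → ℚ
φ a b c = c - ½ * (a · b)

·-expand : ∀ {m} (a b a' b' : Vecℚ m) →
  (a +ᵛ a') · (b +ᵛ b') ≡ a · b + a · b' + (a' · b + a' · b')
·-expand a b a' b' =
  trans (·-distribʳ-+ᵛ a a' (b +ᵛ b'))
    (cong₂ _+_ (·-distribˡ-+ᵛ a b b') (·-distribˡ-+ᵛ a' b b'))

φ-⊗ : ∀ {m} (a b : Vecℚ m) c (a' b' : Vecℚ m) c' → a' · b ≡ a · b' →
  φ (a +ᵛ a') (b +ᵛ b') (c + c' + a · b') ≡ φ a b c + φ a' b' c'
φ-⊗ a b c a' b' c' a'b≡ab' = begin
  c + c' + a · b' - ½ * ((a +ᵛ a') · (b +ᵛ b'))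
    ≡⟨ cong (λ t → c + c' + a · b' - ½ * t) (·-expand a b a' b') ⟩
  c + c' + a · b' - ½ * (a · b + a · b' + (a' · b + a' · b'))
    ≡⟨ cong (λ t → c + c' + a · b' - ½ * (a · b + a · b' + (t + a' · b'))) a'b≡ab' ⟩
  c + c' + a · b' - ½ * (a · b + a · b' + (a · b' + a' · b'))
    ≡⟨ solve 5 (λ c c' x y z → c :+ c' :+ y :- con ½ :* (x :+ y :+ (y :+ z))
                               := c :- con ½ :* x :+ (c' :- con ½ :* z))
         refl c c' (a · b) (a · b') (a' · b') ⟩
  φ a b c + φ a' b' c' ∎

φ-central : ∀ {m} {a : Vecℚ m} b c → (∀ k → a k ≡ 0ℚ) → φ a b c ≡ c
φ-central b c a≗0 =
  trans (cong (λ t → c - ½ * t) (·-zeroˡ b a≗0))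
    (solve 1 (λ x → x :- con ½ :* con 0ℚ := x) refl c)

module _ {m r : ℕ} (a b : Fin r → Vecℚ m) (c : Fin r → ℚ) where

  wordA : Fin r → List (Fin r) → Vecℚ m
  wordA x []       = a x
  wordA x (y ∷ ys) = a x +ᵛ wordA y ys

  wordB : Fin r → List (Fin r) → Vecℚ m
  wordB x []       = b x
  wordB x (y ∷ ys) = b x +ᵛ wordB y ys

  wordC : Fin r → List (Fin r) → ℚ
  wordC x []       = c x
  wordC x (y ∷ ys) = c x + wordC y ys + a x · wordB y ys

  prodMat-word : ∀ x xs → prodMat (map (λ i → HMat (a i) (b i) (c i)) (x ∷ xs))
                          ≈ᴹ HMat (wordA x xs) (wordB x xs) (wordC x xs)
  prodMat-word x []           = ⊗-identityʳ (HMat (a x) (b x) (c x))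
  prodMat-word x (y ∷ ys) p q =
    trans (⊗-congˡ (HMat (a x) (b x) (c x)) (prodMat-word y ys) p q)
      (HMat-⊗ (a x) (b x) (c x) (wordA y ys) (wordB y ys) (wordC y ys) p q)

  module _ (a·b-sym : ∀ i j → a i · b j ≡ a j · b i) where

    wordA-·-b : ∀ x y ys → wordA y ys · b x ≡ a x · wordB y ys
    wordA-·-b x y []       = a·b-sym y x
    wordA-·-b x y (z ∷ zs) = begin
      (a y +ᵛ wordA z zs) · b x       ≡⟨ ·-distribʳ-+ᵛ (a y) (wordA z zs) (b x) ⟩
      a y · b x + wordA z zs · b x    ≡⟨ cong₂ _+_ (a·b-sym y x) (wordA-·-b x z zs) ⟩
      a x · b y + a x · wordB z zs    ≡⟨ ·-distribˡ-+ᵛ (a x) (b y) (wordB z zs) ⟨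
      a x · (b y +ᵛ wordB z zs)       ∎

    φ-word : ∀ x xs → φ (wordA x xs) (wordB x xs) (wordC x xs)
                      ≡ sumL (λ i → φ (a i) (b i) (c i)) (x ∷ xs)
    φ-word x []       = sym (+-identityʳ (φ (a x) (b x) (c x)))
    φ-word x (y ∷ ys) =
      trans (φ-⊗ (a x) (b x) (c x) (wordA y ys) (wordB y ys) (wordC y ys) (wordA-·-b x y ys))
        (cong (φ (a x) (b x) (c x) +_) (φ-word y ys))

sym-off-diagonal⇒sym : ∀ {r} {A : Set} (f : Fin r → Fin r → A) →
  (∀ i j → i ≢ j → f i j ≡ f j i) → ∀ i j → f i j ≡ f j i
sym-off-diagonal⇒sym f f-sym i j with i ≟ j
... | yes refl = refl
... | no  i≢j  = f-sym i j i≢j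

lemma16 : (m r : ℕ) → 1 ≤ m →
    (a b : Fin r → Fin m → ℚ) → (c : Fin r → ℚ) →
    (∀ i j → i ≢ j → (a i · b j) ≡ (a j · b i)) →
    (w : List⁺ (Fin r)) → (c₀ : ℚ) →
    (∀ p q → prodMat (map (λ i → HMat (a i) (b i) (c i)) (toList w)) p q
    ≡ HMat zeroVec zeroVec c₀ p q) →
    c₀ ≡ sumL (λ i → c i - ½ * (a i · b i)) (toList w)
lemma16 m r _ a b c a·b-sym (x ∷ xs) c₀ central = begin
  c₀                                          ≡⟨ entries first last ⟨
  C                                           ≡⟨ φ-central B C (entries first ∘ mid) ⟨
  φ A B C                                     ≡⟨ φ-word a b c a·b-sym′ x xs ⟩
  sumL (λ i → c i - ½ * (a i · b i)) (x ∷ xs) ∎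
  where
  A B : Vecℚ m
  A = wordA a b c x xs
  B = wordB a b c x xs
  C : ℚ
  C = wordC a b c x xs

  entries : ∀ p q → entry A B C p q ≡ entry zeroVec zeroVec c₀ p q
  entries = HMat-≈ᴹ⇒entry (λ p q → trans (sym (prodMat-word a b c x xs p q)) (central p q))

  a·b-sym′ : ∀ i j → a i · b j ≡ a j · b i
  a·b-sym′ = sym-off-diagonal⇒sym (λ i j → a i · b j) a·b-sym
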